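{- Let $p>2$ be a prime, $G$ a finite group, $H\subset G$ a subgroup of index two, and $\rho:G\hookrightarrow\mathrm{GL}_2(\overline{\mathbb F}_p)$ a faithful irreducible representation with trace $T=\operatorname{Tr}\rho:G\to\overline{\mathbb F}_p$. Assume (1) there is an element $c\in G\setminus H$ of order two, and (2) $T(hc)=0$ for all $h\in H$. Then $\rho|_H$ is reducible. -}

module Defs where

open import Level using (0ℓ)
open import Data.Nat using (ℕ; zero; suc; _≤_)
open import Data.Nat.Primality using (Prime)
open import Data.List using (List; []; _∷_; _++_; [_]; length; map)
open import Data.List.Relation.Unary.Any using (Any)
open import Data.Product using (Σ; _×_; _,_; ∃)
open import Data.Sum using (_⊎_)
open import Data.Unit using (⊤)
open import Relation.Nullary using (¬_)
open import Relation.Binary.PropositionalEquality using (_≡_; _≢_)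
open import Relation.Binary.Definitions using (Decidable)
open import Algebra.Bundles using (Group)
open import Algebra.Structures using (IsCommutativeRing)

record Field : Set₁ where
  field
    Carrier : Set
    _+_ _*_ : Carrier → Carrier → Carrier
    -_      : Carrier → Carrier
    0# 1#   : Carrier
    isCommutativeRing : IsCommutativeRing _≡_ _+_ _*_ -_ 0# 1#
    0≢1     : 0# ≢ 1#
    inverse : ∀ x → x ≢ 0# → Σ Carrier λ y → x * y ≡ 1#
    _≟_     : Decidable (_≡_ {A = Carrier})

  infixl 6 _+_
  infixl 7 _*_

  fromℕ : ℕ → Carrier
  fromℕ zero    = 0#
  fromℕ (suc n) = 1# + fromℕ n

  -- polynomial given by its coefficient list (constant term first)
  eval : List Carrier → Carrier → Carrier
  eval []       x = 0#
  eval (c ∷ cs) x = c + x * eval cs x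


module _ (K : Field) where
  open Field K

  -- characteristic p (for p prime): p · 1 = 0
  HasCharacteristic : ℕ → Set
  HasCharacteristic p = fromℕ p ≡ 0#

  -- every monic polynomial of degree ≥ 1 has a root
  AlgebraicallyClosed : Set
  AlgebraicallyClosed =
    ∀ (cs : List Carrier) → 1 ≤ length cs →
    Σ Carrier λ x → eval (cs ++ [ 1# ]) x ≡ 0#

  -- every element is a root of a monic polynomial with coefficients
  -- in the prime subfield (the image of ℕ)
  AlgebraicOverPrimeField : Set
  AlgebraicOverPrimeField =
    ∀ (x : Carrier) → Σ (List ℕ) λ ns → eval (map fromℕ ns ++ [ 1# ]) x ≡ 0#

record IsAlgebraicClosureOfFp (p : ℕ) (K : Field) : Set where
  field
    characteristic : HasCharacteristic K p
    algClosed      : AlgebraicallyClosed K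
    algebraic      : AlgebraicOverPrimeField K

module Linear (K : Field) where
  open Field K

  record M2 : Set where
    constructor mat
    field a b c d : Carrier

  V : Set
  V = Carrier × Carrier

  0v : V
  0v = 0# , 0#

  _⊕_ : V → V → V
  (x₁ , y₁) ⊕ (x₂ , y₂) = (x₁ + x₂) , (y₁ + y₂)

  _·_ : Carrier → V → V
  s · (x , y) = (s * x) , (s * y)

  _⊗_ : M2 → M2 → M2
  mat a b c d ⊗ mat a' b' c' d' =
    mat (a * a' + b * c') (a * b' + b * d') (c * a' + d * c') (c * b' + d * d')

  _$_ : M2 → V → V
  mat a b c d $ (x , y) = (a * x + b * y) , (c * x + d * y)

  det : M2 → Carrier
  det (mat a b c d) = a * d + - (b * c)

  tr : M2 → Carrier
  tr (mat a b c d) = a + d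

  record IsSubspace (W : V → Set) : Set where
    field
      zero-mem : W 0v
      add-mem  : ∀ {u v} → W u → W v → W (u ⊕ v)
      smul-mem : ∀ s {v} → W v → W (s · v)

  record InvariantSubspace {I : Set} (P : I → Set) (M : I → M2) : Set₁ where
    field
      W         : V → Set
      subspace  : IsSubspace W
      nonzero   : Σ V λ v → W v × v ≢ 0v
      proper    : Σ V λ v → ¬ W v
      invariant : ∀ i → P i → ∀ {v} → W v → W (M i $ v)

module GroupStuff (G : Group 0ℓ 0ℓ) where
  open Group G

  IsFinite : Set
  IsFinite = Σ (List Carrier) λ xs → ∀ g → Any (g ≈_) xs

  record IsSubgroup (H : Carrier → Set) : Set where
    field
      resp     : ∀ {x y} → x ≈ y → H x → H y
      ε-mem    : H ε
      ∙-mem    : ∀ {x y} → H x → H y → H (x ∙ y)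
      ⁻¹-mem   : ∀ {x} → H x → H (x ⁻¹)

  -- G = H ∪ aH with a ∉ H : exactly two cosets
  HasIndexTwo : (H : Carrier → Set) → Set
  HasIndexTwo H = Σ Carrier λ a → ¬ H a × (∀ x → H x ⊎ H (a ⁻¹ ∙ x))

  HasOrderTwo : Carrier → Set
  HasOrderTwo c = (c ∙ c ≈ ε) × ¬ (c ≈ ε)

module Rep (K : Field) (G : Group 0ℓ 0ℓ) where
  open Field K
  open Linear K
  open Group G renaming (Carrier to ∣G∣; _≈_ to _≈G_)

  record IsRepresentation (ρ : ∣G∣ → M2) : Set where
    field
      invertible : ∀ g → det (ρ g) ≢ 0#
      resp       : ∀ {g h} → g ≈G h → ρ g ≡ ρ h
      hom        : ∀ g h → ρ (g ∙ h) ≡ ρ g ⊗ ρ h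

  Faithful : (∣G∣ → M2) → Set
  Faithful ρ = ∀ g h → ρ g ≡ ρ h → g ≈G h

  ReducibleOn : (∣G∣ → Set) → (∣G∣ → M2) → Set₁
  ReducibleOn P ρ = InvariantSubspace P ρ

  Irreducible : (∣G∣ → M2) → Set₁
  Irreducible ρ = ¬ InvariantSubspace (λ _ → ⊤) ρ

-- Let C = ρ c. The hypothesis at h = 1, h, h′ and h h′ says that C is traceless
-- and that A = ρ h, B = ρ h′ and A B are orthogonal to C for the trace form.
-- For 2×2 matrices this forces A B = B A: the commutator U = [A, B] is
-- traceless, the Cayley–Hamilton trace identity gives
--   tr (U C) = 2 tr (A B C) − tr A tr (B C) − tr B tr (A C) = 0,
-- and [C, [A, B]] = tr (A C) (B − adj B) − tr (B C) (A − adj A) = 0.  For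
-- traceless U and C one has U C + C U = tr (U C) I, so 2 C U = 0, and since
-- C² = − det C · I with det C ≠ 0 and 2 ≠ 0 (p is odd), U = 0.  Hence ρ(H) is
-- commutative.  Over the algebraically closed K, either some ρ h is not scalar,
-- and the kernel of ρ h − λ for an eigenvalue λ is a ρ(H)-invariant line, or
-- ρ(H) consists of scalars and every line is invariant.
module Submission where

open import Defs
open import Level using (0ℓ)
open import Algebra.Bundles using (Group; CommutativeRing)
import Algebra.Properties.CommutativeSemigroup
import Algebra.Properties.Group
import Algebra.Properties.Monoid.Mult.TCOptimised
import Algebra.Properties.Ring
import Algebra.Properties.Semiring.Mult.TCOptimised
import Algebra.Solver.Ring
import Algebra.Solver.Ring.AlmostCommutativeRing as ACR
open import Data.Empty using (⊥-elim)
open import Data.Fin using (Fin; #_)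
open import Data.Integer using (ℤ; -[1+_]; _⊖_)
import Data.Integer as ℤ
import Data.Integer.Properties as ℤ
open import Data.List using ([]; _∷_)
open import Data.List.Relation.Unary.Any as Any using (any?; satisfied)
import Data.Maybe as Maybe
open import Data.Nat using (ℕ; zero; suc; _<_; s≤s; z≤n)
import Data.Nat as ℕ
import Data.Nat.Properties as ℕ
open import Data.Nat.Divisibility using (_∣_; divides; ∣-refl; ∣m∣n⇒∣m+n)
open import Data.Nat.Primality using (Prime; composite)
open import Data.Product using (Σ; _×_; _,_; proj₁; proj₂)
import Data.Product as Product
open import Data.Product.Properties using (≡-dec)
open import Data.Sign using (Sign)
import Data.Sign as Sign
open import Data.Sum using (_⊎_; inj₁; inj₂)
import Data.Sum as Sum
open import Data.Vec using (Vec; []; _∷_)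
open import Relation.Nullary using (¬_; Dec; yes; no)
open import Relation.Nullary.Decidable using (dec⇒maybe; decidable-stable; _×-dec_; ¬?)
open import Relation.Binary.PropositionalEquality
  using (_≡_; _≢_; refl; sym; trans; cong; cong₂; subst; module ≡-Reasoning)

module FieldSolver (K : Field) where
  open Field K using (isCommutativeRing)

  commutativeRing : CommutativeRing 0ℓ 0ℓ
  commutativeRing = record { isCommutativeRing = isCommutativeRing }

  open CommutativeRing commutativeRing hiding (refl; sym; trans)
  open Algebra.Properties.Ring ring using (-0#≈0#; -‿involutive; -‿distribˡ-*; -‿distribʳ-*; -‿+-comm)
  open Algebra.Properties.Monoid.Mult.TCOptimised +-monoid using (1+×; ×-homo-+) renaming (_×_ to _×′_)
  open Algebra.Properties.Semiring.Mult.TCOptimised semiring using (×1-homo-*)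
  open Algebra.Properties.CommutativeSemigroup +-commutativeSemigroup using (interchange)
  open ≡-Reasoning

  -- Built from the optimised multiple _×′_ so that the solver's constants 0 and 1
  -- evaluate to 0# and 1# definitionally.
  ⟪_⟫ : ℤ → Carrier
  ⟪ ℤ.+ n ⟫    = n ×′ 1#
  ⟪ -[1+ n ] ⟫ = - (suc n ×′ 1#)

  signed : Sign → Carrier → Carrier
  signed Sign.+ x = x
  signed Sign.- x = - x

  ⟪⟫-sign-abs : ∀ i → ⟪ i ⟫ ≡ signed (ℤ.sign i) (ℤ.∣ i ∣ ×′ 1#)
  ⟪⟫-sign-abs (ℤ.+ n)    = refl
  ⟪⟫-sign-abs -[1+ n ]   = refl

  ⟪⟫-◃ : ∀ s n → ⟪ s ℤ.◃ n ⟫ ≡ signed s (n ×′ 1#)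
  ⟪⟫-◃ Sign.+ zero    = refl
  ⟪⟫-◃ Sign.- zero    = sym -0#≈0#
  ⟪⟫-◃ Sign.+ (suc n) = refl
  ⟪⟫-◃ Sign.- (suc n) = refl

  signed-* : ∀ s t x y → signed (s Sign.* t) (x * y) ≡ signed s x * signed t y
  signed-* Sign.+ Sign.+ x y = refl
  signed-* Sign.+ Sign.- x y = -‿distribʳ-* x y
  signed-* Sign.- Sign.+ x y = -‿distribˡ-* x y
  signed-* Sign.- Sign.- x y = begin
    x * y         ≡⟨ sym (-‿involutive (x * y)) ⟩
    - - (x * y)   ≡⟨ cong -_ (-‿distribˡ-* x y) ⟩
    - (- x * y)   ≡⟨ -‿distribʳ-* (- x) y ⟩
    - x * - y     ∎

  ⟪⟫-* : ∀ i j → ⟪ i ℤ.* j ⟫ ≡ ⟪ i ⟫ * ⟪ j ⟫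
  ⟪⟫-* i j = begin
    ⟪ i ℤ.* j ⟫
      ≡⟨ ⟪⟫-◃ (s Sign.* t) (m ℕ.* n) ⟩
    signed (s Sign.* t) ((m ℕ.* n) ×′ 1#)
      ≡⟨ cong (signed (s Sign.* t)) (×1-homo-* m n) ⟩
    signed (s Sign.* t) ((m ×′ 1#) * (n ×′ 1#))
      ≡⟨ signed-* s t (m ×′ 1#) (n ×′ 1#) ⟩
    signed s (m ×′ 1#) * signed t (n ×′ 1#)
      ≡⟨ sym (cong₂ _*_ (⟪⟫-sign-abs i) (⟪⟫-sign-abs j)) ⟩
    ⟪ i ⟫ * ⟪ j ⟫ ∎
    where
    s t : Sign
    s = ℤ.sign i
    t = ℤ.sign j
    m n : ℕ
    m = ℤ.∣ i ∣
    n = ℤ.∣ j ∣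

  ⟪⟫-⊖ : ∀ m n → ⟪ m ⊖ n ⟫ ≡ m ×′ 1# + - (n ×′ 1#)
  ⟪⟫-⊖ m       zero    = sym (trans (cong ((m ×′ 1#) +_) -0#≈0#) (+-identityʳ (m ×′ 1#)))
  ⟪⟫-⊖ zero    (suc n) = sym (+-identityˡ _)
  ⟪⟫-⊖ (suc m) (suc n) = begin
    ⟪ suc m ⊖ suc n ⟫             ≡⟨ cong ⟪_⟫ (ℤ.[1+m]⊖[1+n]≡m⊖n m n) ⟩
    ⟪ m ⊖ n ⟫                     ≡⟨ ⟪⟫-⊖ m n ⟩
    x + - y                       ≡⟨ sym (+-identityˡ (x + - y)) ⟩
    0# + (x + - y)                ≡⟨ cong (_+ (x + - y)) (sym (-‿inverseʳ 1#)) ⟩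
    (1# + - 1#) + (x + - y)       ≡⟨ interchange 1# (- 1#) x (- y) ⟩
    (1# + x) + (- 1# + - y)       ≡⟨ cong₂ _+_ (sym (1+× m 1#)) (-‿+-comm 1# y) ⟩
    suc m ×′ 1# + - (1# + y)       ≡⟨ cong (λ u → suc m ×′ 1# + - u) (sym (1+× n 1#)) ⟩
    suc m ×′ 1# + - (suc n ×′ 1#)   ∎
    where
    x y : Carrier
    x = m ×′ 1#
    y = n ×′ 1#

  ⟪⟫-+ : ∀ i j → ⟪ i ℤ.+ j ⟫ ≡ ⟪ i ⟫ + ⟪ j ⟫
  ⟪⟫-+ (ℤ.+ m)    (ℤ.+ n)    = ×-homo-+ 1# m n
  ⟪⟫-+ (ℤ.+ m)    -[1+ n ]   = ⟪⟫-⊖ m (suc n)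
  ⟪⟫-+ -[1+ m ]   (ℤ.+ n)    = trans (⟪⟫-⊖ n (suc m)) (+-comm _ _)
  ⟪⟫-+ -[1+ m ]   -[1+ n ]   = begin
    - (suc (suc (m ℕ.+ n)) ×′ 1#)          ≡⟨ cong (λ k → - (suc k ×′ 1#)) (sym (ℕ.+-suc m n)) ⟩
    - ((suc m ℕ.+ suc n) ×′ 1#)            ≡⟨ cong -_ (×-homo-+ 1# (suc m) (suc n)) ⟩
    - (suc m ×′ 1# + suc n ×′ 1#)           ≡⟨ sym (-‿+-comm (suc m ×′ 1#) (suc n ×′ 1#)) ⟩
    - (suc m ×′ 1#) + - (suc n ×′ 1#)       ∎

  ⟪⟫-neg : ∀ i → ⟪ ℤ.- i ⟫ ≡ - ⟪ i ⟫
  ⟪⟫-neg (ℤ.+ zero)    = sym -0#≈0#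
  ⟪⟫-neg (ℤ.+ suc n)   = refl
  ⟪⟫-neg -[1+ n ]    = sym (-‿involutive _)

  ⟪⟫-morphism : CommutativeRing.rawRing ℤ.+-*-commutativeRing ACR.-Raw-AlmostCommutative⟶ ACR.fromCommutativeRing commutativeRing
  ⟪⟫-morphism = record
    { ⟦_⟧ = ⟪_⟫ ; +-homo = ⟪⟫-+ ; *-homo = ⟪⟫-* ; -‿homo = ⟪⟫-neg ; 0-homo = refl ; 1-homo = refl }

  open Algebra.Solver.Ring _ _ ⟪⟫-morphism (λ i j → Maybe.map (cong ⟪_⟫) (dec⇒maybe (i ℤ.≟ j)))
    public using (Polynomial; var; con; _:+_; _:*_; :-_; _:-_; ⟦_⟧; ⟦_⟧↓; prove; solve; _:=_)


module Matrices (K : Field) where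
  open Field K
  open Linear K
  open FieldSolver K
  open CommutativeRing commutativeRing using (_-_; +-group; +-identityˡ; *-identityˡ; *-identityʳ; *-assoc; *-comm; zeroˡ; zeroʳ; distribʳ)
  open Algebra.Properties.Group +-group using (x∙y⁻¹≈ε⇒x≈y; x≈y⇒x∙y⁻¹≈ε; inverseʳ-unique; ⁻¹-selfInverse; ε⁻¹≈ε)
  open ≡-Reasoning

  infixl 6 _⊞_ _⊟_
  infixr 7 _⊙_

  x-y≡0⇒x≡y : ∀ {x y} → x - y ≡ 0# → x ≡ y
  x-y≡0⇒x≡y = x∙y⁻¹≈ε⇒x≈y _ _

  -x≡0⇒x≡0 : ∀ {x} → - x ≡ 0# → x ≡ 0#
  -x≡0⇒x≡0 -x≡0 = trans (sym (⁻¹-selfInverse -x≡0)) ε⁻¹≈ε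

  *-cancelˡ-≢0 : ∀ {k x} → k ≢ 0# → k * x ≡ 0# → x ≡ 0#
  *-cancelˡ-≢0 {k} {x} k≢0 kx≡0 with inverse k k≢0
  ... | k⁻¹ , kk⁻¹≡1 = begin
    x              ≡⟨ sym (*-identityˡ x) ⟩
    1# * x         ≡⟨ cong (_* x) (sym kk⁻¹≡1) ⟩
    k * k⁻¹ * x    ≡⟨ cong (_* x) (*-comm k k⁻¹) ⟩
    k⁻¹ * k * x    ≡⟨ *-assoc k⁻¹ k x ⟩
    k⁻¹ * (k * x)  ≡⟨ cong (k⁻¹ *_) kx≡0 ⟩
    k⁻¹ * 0#       ≡⟨ zeroʳ k⁻¹ ⟩
    0#             ∎

  _⊞_ _⊟_ : M2 → M2 → M2
  mat a b c d ⊞ mat a′ b′ c′ d′ = mat (a + a′) (b + b′) (c + c′) (d + d′)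
  mat a b c d ⊟ mat a′ b′ c′ d′ = mat (a - a′) (b - b′) (c - c′) (d - d′)

  _⊙_ : Carrier → M2 → M2
  k ⊙ mat a b c d = mat (k * a) (k * b) (k * c) (k * d)

  O I : M2
  O = mat 0# 0# 0# 0#
  I = mat 1# 0# 0# 1#

  adj : M2 → M2
  adj (mat a b c d) = mat d (- b) (- c) a

  [_,_] : M2 → M2 → M2
  [ A , B ] = A ⊗ B ⊟ B ⊗ A

  -- Each operation copies
  -- the concrete one clause by clause, so the semantics of a symbolic
  -- expression is definitionally the corresponding concrete matrix, and a
  -- solver call can be stated in matrix notation.
  record Matₚ (n : ℕ) : Set where
    constructor matₚ
    field a b c d : Polynomial n

  module _ {n : ℕ} where
    infixl 6 _⊞ₚ_ _⊟ₚ_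
    infixr 7 _⊙ₚ_

    _⊗ₚ_ _⊞ₚ_ _⊟ₚ_ [_,_]ₚ : Matₚ n → Matₚ n → Matₚ n
    matₚ a b c d ⊗ₚ matₚ a′ b′ c′ d′ =
      matₚ (a :* a′ :+ b :* c′) (a :* b′ :+ b :* d′) (c :* a′ :+ d :* c′) (c :* b′ :+ d :* d′)
    matₚ a b c d ⊞ₚ matₚ a′ b′ c′ d′ = matₚ (a :+ a′) (b :+ b′) (c :+ c′) (d :+ d′)
    matₚ a b c d ⊟ₚ matₚ a′ b′ c′ d′ = matₚ (a :- a′) (b :- b′) (c :- c′) (d :- d′)
    [ A , B ]ₚ = A ⊗ₚ B ⊟ₚ B ⊗ₚ A

    _⊙ₚ_ : Polynomial n → Matₚ n → Matₚ n
    k ⊙ₚ matₚ a b c d = matₚ (k :* a) (k :* b) (k :* c) (k :* d)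

    trₚ detₚ : Matₚ n → Polynomial n
    trₚ (matₚ a b c d) = a :+ d
    detₚ (matₚ a b c d) = a :* d :+ :- (b :* c)

    adjₚ : Matₚ n → Matₚ n
    adjₚ (matₚ a b c d) = matₚ d (:- b) (:- c) a

    0ₚ 1ₚ : Polynomial n
    0ₚ = con (ℤ.+ 0)
    1ₚ = con (ℤ.+ 1)

    Iₚ : Matₚ n
    Iₚ = matₚ 1ₚ 0ₚ 0ₚ 1ₚ

    varₘ : Fin n → Fin n → Fin n → Fin n → Matₚ n
    varₘ i j k l = matₚ (var i) (var j) (var k) (var l)

    tracelessₚ : Fin n → Fin n → Fin n → Matₚ n
    tracelessₚ i j k = matₚ (var i) (var j) (var k) (:- var i)

    ⟦_⟧ₘ : Matₚ n → Vec Carrier n → M2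
    ⟦ matₚ a b c d ⟧ₘ ρ = mat (⟦ a ⟧ ρ) (⟦ b ⟧ ρ) (⟦ c ⟧ ρ) (⟦ d ⟧ ρ)

    Vₚ : Set
    Vₚ = Polynomial n × Polynomial n

    _$ₚ_ : Matₚ n → Vₚ → Vₚ
    matₚ a b c d $ₚ (x , y) = (a :* x :+ b :* y) , (c :* x :+ d :* y)

    ⟦_⟧ᵥ : Vₚ → Vec Carrier n → V
    ⟦ x , y ⟧ᵥ ρ = ⟦ x ⟧ ρ , ⟦ y ⟧ ρ

  mat-cong : ∀ {a b c d a′ b′ c′ d′} → a ≡ a′ → b ≡ b′ → c ≡ c′ → d ≡ d′ → mat a b c d ≡ mat a′ b′ c′ d′
  mat-cong refl refl refl refl = refl

  proveₘ : ∀ {n} (ρ : Vec Carrier n) (P Q : Matₚ n) →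
    ⟦ Matₚ.a P ⟧↓ ρ ≡ ⟦ Matₚ.a Q ⟧↓ ρ → ⟦ Matₚ.b P ⟧↓ ρ ≡ ⟦ Matₚ.b Q ⟧↓ ρ →
    ⟦ Matₚ.c P ⟧↓ ρ ≡ ⟦ Matₚ.c Q ⟧↓ ρ → ⟦ Matₚ.d P ⟧↓ ρ ≡ ⟦ Matₚ.d Q ⟧↓ ρ →
    ⟦ P ⟧ₘ ρ ≡ ⟦ Q ⟧ₘ ρ
  proveₘ ρ (matₚ a b c d) (matₚ a′ b′ c′ d′) a≡ b≡ c≡ d≡ =
    mat-cong (prove ρ a a′ a≡) (prove ρ b b′ b≡) (prove ρ c c′ c≡) (prove ρ d d′ d≡)

  proveᵥ : ∀ {n} (ρ : Vec Carrier n) (u v : Vₚ) →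
    ⟦ proj₁ u ⟧↓ ρ ≡ ⟦ proj₁ v ⟧↓ ρ → ⟦ proj₂ u ⟧↓ ρ ≡ ⟦ proj₂ v ⟧↓ ρ → ⟦ u ⟧ᵥ ρ ≡ ⟦ v ⟧ᵥ ρ
  proveᵥ ρ (x , y) (x′ , y′) x≡ y≡ = cong₂ _,_ (prove ρ x x′ x≡) (prove ρ y y′ y≡)

  ⊟≡O⇒≡ : ∀ {M N} → M ⊟ N ≡ O → M ≡ N
  ⊟≡O⇒≡ {mat _ _ _ _} {mat _ _ _ _} eq =
    mat-cong (x-y≡0⇒x≡y (cong M2.a eq)) (x-y≡0⇒x≡y (cong M2.b eq)) (x-y≡0⇒x≡y (cong M2.c eq)) (x-y≡0⇒x≡y (cong M2.d eq))

  ≡⇒⊟≡O : ∀ {M N} → M ≡ N → M ⊟ N ≡ O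
  ≡⇒⊟≡O {mat _ _ _ _} refl = mat-cong (x≈y⇒x∙y⁻¹≈ε refl) (x≈y⇒x∙y⁻¹≈ε refl) (x≈y⇒x∙y⁻¹≈ε refl) (x≈y⇒x∙y⁻¹≈ε refl)

  ⊙-cancel : ∀ {k M} → k ≢ 0# → k ⊙ M ≡ O → M ≡ O
  ⊙-cancel {M = mat _ _ _ _} k≢0 eq =
    mat-cong (*-cancelˡ-≢0 k≢0 (cong M2.a eq)) (*-cancelˡ-≢0 k≢0 (cong M2.b eq))
             (*-cancelˡ-≢0 k≢0 (cong M2.c eq)) (*-cancelˡ-≢0 k≢0 (cong M2.d eq))

  0⊙ : ∀ M → 0# ⊙ M ≡ O
  0⊙ (mat a b c d) = mat-cong (zeroˡ a) (zeroˡ b) (zeroˡ c) (zeroˡ d)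

  2⊙ : ∀ M → (1# + 1#) ⊙ M ≡ M ⊞ M
  2⊙ (mat a b c d) = mat-cong (double a) (double b) (double c) (double d)
    where
    double : ∀ x → (1# + 1#) * x ≡ x + x
    double x = trans (distribʳ x 1# 1#) (cong₂ _+_ (*-identityˡ x) (*-identityˡ x))

  x*0+y*0≡0 : ∀ x y → x * 0# + y * 0# ≡ 0#
  x*0+y*0≡0 = solve 2 (λ x y → x :* 0ₚ :+ y :* 0ₚ := 0ₚ) refl

  O⊟O : O ⊟ O ≡ O
  O⊟O = ≡⇒⊟≡O refl

  ⊗-zeroʳ : ∀ M → M ⊗ O ≡ O
  ⊗-zeroʳ (mat a b c d) = mat-cong (x*0+y*0≡0 a b) (x*0+y*0≡0 a b) (x*0+y*0≡0 c d) (x*0+y*0≡0 c d)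

  data Traceless : M2 → Set where
    traceless : ∀ a b c → Traceless (mat a b c (- a))

  traceless-view : ∀ C → tr C ≡ 0# → Traceless C
  traceless-view (mat a b c d) a+d≡0 =
    subst (λ d → Traceless (mat a b c d)) (sym (inverseʳ-unique a d a+d≡0)) (traceless a b c)

  tr-[,] : ∀ A B → tr [ A , B ] ≡ 0#
  tr-[,] (mat x y z w) (mat X Y Z W) =
    prove (x ∷ y ∷ z ∷ w ∷ X ∷ Y ∷ Z ∷ W ∷ []) (trₚ [ Aₚ , Bₚ ]ₚ) 0ₚ refl
    where
    Aₚ Bₚ : Matₚ 8
    Aₚ = varₘ (# 0) (# 1) (# 2) (# 3)
    Bₚ = varₘ (# 4) (# 5) (# 6) (# 7)

  tr-[,]⊗ : ∀ A B {C} → tr C ≡ 0# →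
    tr ([ A , B ] ⊗ C) ≡ tr ((A ⊗ B) ⊗ C) + tr ((A ⊗ B) ⊗ C) - (tr A * tr (B ⊗ C) + tr B * tr (A ⊗ C))
  tr-[,]⊗ (mat x y z w) (mat X Y Z W) {C} trC with traceless-view C trC
  ... | traceless a b c = prove (x ∷ y ∷ z ∷ w ∷ X ∷ Y ∷ Z ∷ W ∷ a ∷ b ∷ c ∷ [])
    (trₚ ([ Aₚ , Bₚ ]ₚ ⊗ₚ Cₚ))
    (trₚ ((Aₚ ⊗ₚ Bₚ) ⊗ₚ Cₚ) :+ trₚ ((Aₚ ⊗ₚ Bₚ) ⊗ₚ Cₚ) :- (trₚ Aₚ :* trₚ (Bₚ ⊗ₚ Cₚ) :+ trₚ Bₚ :* trₚ (Aₚ ⊗ₚ Cₚ)))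
    refl
    where
    Aₚ Bₚ Cₚ : Matₚ 11
    Aₚ = varₘ (# 0) (# 1) (# 2) (# 3)
    Bₚ = varₘ (# 4) (# 5) (# 6) (# 7)
    Cₚ = tracelessₚ (# 8) (# 9) (# 10)

  [,[,]]-traceless : ∀ A B {C} → tr C ≡ 0# →
    [ C , [ A , B ] ] ≡ tr (A ⊗ C) ⊙ (B ⊟ adj B) ⊟ tr (B ⊗ C) ⊙ (A ⊟ adj A)
  [,[,]]-traceless (mat x y z w) (mat X Y Z W) {C} trC with traceless-view C trC
  ... | traceless a b c = proveₘ (x ∷ y ∷ z ∷ w ∷ X ∷ Y ∷ Z ∷ W ∷ a ∷ b ∷ c ∷ [])
    [ Cₚ , [ Aₚ , Bₚ ]ₚ ]ₚ (trₚ (Aₚ ⊗ₚ Cₚ) ⊙ₚ (Bₚ ⊟ₚ adjₚ Bₚ) ⊟ₚ trₚ (Bₚ ⊗ₚ Cₚ) ⊙ₚ (Aₚ ⊟ₚ adjₚ Aₚ))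
    refl refl refl refl
    where
    Aₚ Bₚ Cₚ : Matₚ 11
    Aₚ = varₘ (# 0) (# 1) (# 2) (# 3)
    Bₚ = varₘ (# 4) (# 5) (# 6) (# 7)
    Cₚ = tracelessₚ (# 8) (# 9) (# 10)

  anticommutator-traceless : ∀ {U C} → tr U ≡ 0# → tr C ≡ 0# → U ⊗ C ⊞ C ⊗ U ≡ tr (U ⊗ C) ⊙ I
  anticommutator-traceless {U} {C} trU trC with traceless-view U trU | traceless-view C trC
  ... | traceless p q r | traceless a b c = proveₘ (p ∷ q ∷ r ∷ a ∷ b ∷ c ∷ [])
    (Uₚ ⊗ₚ Cₚ ⊞ₚ Cₚ ⊗ₚ Uₚ) (trₚ (Uₚ ⊗ₚ Cₚ) ⊙ₚ Iₚ) refl refl refl refl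
    where
    Uₚ Cₚ : Matₚ 6
    Uₚ = tracelessₚ (# 0) (# 1) (# 2)
    Cₚ = tracelessₚ (# 3) (# 4) (# 5)

  traceless-square : ∀ {C} → tr C ≡ 0# → ∀ M → C ⊗ (C ⊗ M) ≡ (- det C) ⊙ M
  traceless-square {C} trC (mat x y z w) with traceless-view C trC
  ... | traceless a b c = proveₘ (a ∷ b ∷ c ∷ x ∷ y ∷ z ∷ w ∷ [])
    (Cₚ ⊗ₚ (Cₚ ⊗ₚ Mₚ)) ((:- detₚ Cₚ) ⊙ₚ Mₚ) refl refl refl refl
    where
    Cₚ Mₚ : Matₚ 7
    Cₚ = tracelessₚ (# 0) (# 1) (# 2)
    Mₚ = varₘ (# 3) (# 4) (# 5) (# 6)

  [,]≡O⇒comm : ∀ {A B} → [ A , B ] ≡ O → A ⊗ B ≡ B ⊗ A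
  [,]≡O⇒comm {A} {B} = ⊟≡O⇒≡ {A ⊗ B} {B ⊗ A}

  tr-[,]⊗≡0 : ∀ {A B C} → tr C ≡ 0# → tr (A ⊗ C) ≡ 0# → tr (B ⊗ C) ≡ 0# → tr ((A ⊗ B) ⊗ C) ≡ 0# →
    tr ([ A , B ] ⊗ C) ≡ 0#
  tr-[,]⊗≡0 {A} {B} {C} trC trAC trBC trABC = begin
    tr ([ A , B ] ⊗ C)                                                         ≡⟨ tr-[,]⊗ A B trC ⟩
    tr ((A ⊗ B) ⊗ C) + tr ((A ⊗ B) ⊗ C) - (tr A * tr (B ⊗ C) + tr B * tr (A ⊗ C))
      ≡⟨ cong₂ (λ h k → h + h - k) trABC (cong₂ (λ g f → tr A * g + tr B * f) trBC trAC) ⟩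
    0# + 0# - (tr A * 0# + tr B * 0#)
      ≡⟨ solve 2 (λ x y → 0ₚ :+ 0ₚ :- (x :* 0ₚ :+ y :* 0ₚ) := 0ₚ) refl (tr A) (tr B) ⟩
    0#                                                                         ∎

  trace-orthogonal⇒comm-[,] : ∀ {A B C} → tr C ≡ 0# → tr (A ⊗ C) ≡ 0# → tr (B ⊗ C) ≡ 0# →
    C ⊗ [ A , B ] ≡ [ A , B ] ⊗ C
  trace-orthogonal⇒comm-[,] {A} {B} {C} trC trAC trBC = [,]≡O⇒comm (begin
    [ C , [ A , B ] ]                                              ≡⟨ [,[,]]-traceless A B trC ⟩
    tr (A ⊗ C) ⊙ (B ⊟ adj B) ⊟ tr (B ⊗ C) ⊙ (A ⊟ adj A)          ≡⟨ cong₂ (λ f g → f ⊙ (B ⊟ adj B) ⊟ g ⊙ (A ⊟ adj A)) trAC trBC ⟩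
    0# ⊙ (B ⊟ adj B) ⊟ 0# ⊙ (A ⊟ adj A)                           ≡⟨ cong₂ _⊟_ (0⊙ (B ⊟ adj B)) (0⊙ (A ⊟ adj A)) ⟩
    O ⊟ O                                                          ≡⟨ O⊟O ⟩
    O                                                              ∎)

  trace-orthogonal⇒comm : 1# + 1# ≢ 0# → ∀ {A B C} → tr C ≡ 0# → det C ≢ 0# →
    tr (A ⊗ C) ≡ 0# → tr (B ⊗ C) ≡ 0# → tr ((A ⊗ B) ⊗ C) ≡ 0# → A ⊗ B ≡ B ⊗ A
  trace-orthogonal⇒comm 2≢0 {A} {B} {C} trC detC≢0 trAC trBC trABC = [,]≡O⇒comm U≡O
    where
    U : M2
    U = [ A , B ]

    CU≡O : C ⊗ U ≡ O
    CU≡O = ⊙-cancel 2≢0 (begin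
      (1# + 1#) ⊙ (C ⊗ U)  ≡⟨ 2⊙ (C ⊗ U) ⟩
      C ⊗ U ⊞ C ⊗ U        ≡⟨ cong (_⊞ C ⊗ U) (trace-orthogonal⇒comm-[,] trC trAC trBC) ⟩
      U ⊗ C ⊞ C ⊗ U        ≡⟨ anticommutator-traceless (tr-[,] A B) trC ⟩
      tr (U ⊗ C) ⊙ I       ≡⟨ cong (_⊙ I) (tr-[,]⊗≡0 trC trAC trBC trABC) ⟩
      0# ⊙ I               ≡⟨ 0⊙ I ⟩
      O                    ∎)

    U≡O : U ≡ O
    U≡O = ⊙-cancel (λ -detC≡0 → detC≢0 (-x≡0⇒x≡0 -detC≡0)) (begin
      (- det C) ⊙ U        ≡⟨ sym (traceless-square trC U) ⟩
      C ⊗ (C ⊗ U)          ≡⟨ cong (C ⊗_) CU≡O ⟩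
      C ⊗ O                ≡⟨ ⊗-zeroʳ C ⟩
      O                    ∎)

  Scalar : M2 → Set
  Scalar A = Σ Carrier λ k → A ≡ k ⊙ I

  scalar? : ∀ A → Dec (Scalar A)
  scalar? (mat p q r s) with q ≟ 0# | r ≟ 0# | p ≟ s
  ... | yes refl | yes refl | yes refl =
    yes (p , mat-cong (sym (*-identityʳ p)) (sym (zeroʳ p)) (sym (zeroʳ p)) (sym (*-identityʳ p)))
  ... | no q≢0 | _ | _ = no λ (k , A≡kI) → q≢0 (trans (cong M2.b A≡kI) (zeroʳ k))
  ... | _ | no r≢0 | _ = no λ (k , A≡kI) → r≢0 (trans (cong M2.c A≡kI) (zeroʳ k))
  ... | _ | _ | no p≢s = no λ (k , A≡kI) → p≢s (trans (cong M2.a A≡kI) (sym (cong M2.d A≡kI)))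

  scalar-central : ∀ {A} → Scalar A → ∀ M → A ⊗ M ≡ M ⊗ A
  scalar-central (k , refl) (mat x y z w) = proveₘ (k ∷ x ∷ y ∷ z ∷ w ∷ [])
    ((var (# 0) ⊙ₚ Iₚ) ⊗ₚ Mₚ) (Mₚ ⊗ₚ (var (# 0) ⊙ₚ Iₚ)) refl refl refl refl
    where
    Mₚ : Matₚ 5
    Mₚ = varₘ (# 1) (# 2) (# 3) (# 4)

  E₁₁ : M2
  E₁₁ = mat 1# 0# 0# 0#

  E₁₁-nonscalar : ¬ Scalar E₁₁
  E₁₁-nonscalar (k , E₁₁≡kI) = 0≢1 (trans (cong M2.d E₁₁≡kI) (sym (cong M2.a E₁₁≡kI)))

  [,]-⊟⊙I : ∀ A M k → [ A ⊟ k ⊙ I , M ] ≡ [ A , M ]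
  [,]-⊟⊙I (mat p q r s) (mat x y z w) k = proveₘ (p ∷ q ∷ r ∷ s ∷ x ∷ y ∷ z ∷ w ∷ k ∷ [])
    [ Aₚ ⊟ₚ var (# 8) ⊙ₚ Iₚ , Mₚ ]ₚ [ Aₚ , Mₚ ]ₚ refl refl refl refl
    where
    Aₚ Mₚ : Matₚ 9
    Aₚ = varₘ (# 0) (# 1) (# 2) (# 3)
    Mₚ = varₘ (# 4) (# 5) (# 6) (# 7)

  eigenvalue : AlgebraicallyClosed K → ∀ A → Σ Carrier λ l → det (A ⊟ l ⊙ I) ≡ 0#
  eigenvalue closed A@(mat p q r s) with closed (det A ∷ - tr A ∷ []) (s≤s z≤n)
  ... | l , root = l , trans (charPoly p q r s l) root
    where
    charPoly : ∀ p q r s l → det (mat p q r s ⊟ l ⊙ I) ≡ eval (det (mat p q r s) ∷ - tr (mat p q r s) ∷ 1# ∷ []) l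
    charPoly = solve 5 (λ p q r s l →
      detₚ (matₚ p q r s ⊟ₚ l ⊙ₚ Iₚ) := detₚ (matₚ p q r s) :+ l :* (:- trₚ (matₚ p q r s) :+ l :* (1ₚ :+ l :* 0ₚ))) refl

  Kernel : M2 → V → Set
  Kernel N v = N $ v ≡ 0v

  $-⊗ : ∀ M N v → (M ⊗ N) $ v ≡ M $ (N $ v)
  $-⊗ (mat a b c d) (mat a′ b′ c′ d′) (x , y) = proveᵥ (a ∷ b ∷ c ∷ d ∷ a′ ∷ b′ ∷ c′ ∷ d′ ∷ x ∷ y ∷ [])
    ((Mₚ ⊗ₚ Nₚ) $ₚ vₚ) (Mₚ $ₚ (Nₚ $ₚ vₚ)) refl refl
    where
    Mₚ Nₚ : Matₚ 10
    Mₚ = varₘ (# 0) (# 1) (# 2) (# 3)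
    Nₚ = varₘ (# 4) (# 5) (# 6) (# 7)
    vₚ : Vₚ
    vₚ = var (# 8) , var (# 9)

  $-⊕ : ∀ M u v → M $ (u ⊕ v) ≡ (M $ u) ⊕ (M $ v)
  $-⊕ (mat a b c d) (x , y) (x′ , y′) = cong₂ _,_ (row a b) (row c d)
    where
    row : ∀ a b → a * (x + x′) + b * (y + y′) ≡ (a * x + b * y) + (a * x′ + b * y′)
    row a b = solve 6 (λ a b x y x′ y′ → a :* (x :+ x′) :+ b :* (y :+ y′) := (a :* x :+ b :* y) :+ (a :* x′ :+ b :* y′))
      refl a b x y x′ y′

  $-· : ∀ M s v → M $ (s · v) ≡ s · (M $ v)
  $-· (mat a b c d) s (x , y) = cong₂ _,_ (row a b) (row c d)
    where
    row : ∀ a b → a * (s * x) + b * (s * y) ≡ s * (a * x + b * y)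
    row a b = solve 5 (λ a b s x y → a :* (s :* x) :+ b :* (s :* y) := s :* (a :* x :+ b :* y)) refl a b s x y

  $-0v : ∀ M → M $ 0v ≡ 0v
  $-0v (mat a b c d) = cong₂ _,_ (x*0+y*0≡0 a b) (x*0+y*0≡0 c d)

  kernel-subspace : ∀ N → IsSubspace (Kernel N)
  kernel-subspace N = record
    { zero-mem = $-0v N
    ; add-mem  = λ {u} {v} Nu≡0 Nv≡0 → begin
        N $ (u ⊕ v)          ≡⟨ $-⊕ N u v ⟩
        (N $ u) ⊕ (N $ v)    ≡⟨ cong₂ _⊕_ Nu≡0 Nv≡0 ⟩
        0v ⊕ 0v              ≡⟨ cong₂ _,_ (+-identityˡ 0#) (+-identityˡ 0#) ⟩
        0v                   ∎
    ; smul-mem = λ s {v} Nv≡0 → begin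
        N $ (s · v)          ≡⟨ $-· N s v ⟩
        s · (N $ v)          ≡⟨ cong (s ·_) Nv≡0 ⟩
        s · 0v               ≡⟨ cong₂ _,_ (zeroʳ s) (zeroʳ s) ⟩
        0v                   ∎
    }

  comm⇒kernel-invariant : ∀ {M N v} → M ⊗ N ≡ N ⊗ M → Kernel N v → Kernel N (M $ v)
  comm⇒kernel-invariant {M} {N} {v} MN≡NM Nv≡0 = begin
    N $ (M $ v)          ≡⟨ sym ($-⊗ N M v) ⟩
    (N ⊗ M) $ v          ≡⟨ cong (_$ v) (sym MN≡NM) ⟩
    (M ⊗ N) $ v          ≡⟨ $-⊗ M N v ⟩
    M $ (N $ v)          ≡⟨ cong (M $_) Nv≡0 ⟩
    M $ 0v               ≡⟨ $-0v M ⟩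
    0v                   ∎

  singular⇒kernel-nonzero : ∀ N → det N ≡ 0# → Σ V λ v → Kernel N v × v ≢ 0v
  singular⇒kernel-nonzero (mat a b c d) det≡0 with a ≟ 0# | c ≟ 0#
  ... | no a≢0 | _ = (- b , a) , trans ker (cong (0# ,_) det≡0) , λ v≡0 → a≢0 (cong proj₂ v≡0)
    where
    ker : mat a b c d $ (- b , a) ≡ (0# , det (mat a b c d))
    ker = proveᵥ (a ∷ b ∷ c ∷ d ∷ []) (varₘ (# 0) (# 1) (# 2) (# 3) $ₚ (:- var (# 1) , var (# 0)))
      (0ₚ , detₚ (varₘ (# 0) (# 1) (# 2) (# 3))) refl refl
  ... | yes refl | no c≢0 = (d , - c) , trans ker (cong (_, 0#) det≡0) , λ v≡0 → c≢0 (-x≡0⇒x≡0 (cong proj₂ v≡0))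
    where
    ker : mat 0# b c d $ (d , - c) ≡ (det (mat 0# b c d) , 0#)
    ker = proveᵥ (b ∷ c ∷ d ∷ []) (matₚ 0ₚ (var (# 0)) (var (# 1)) (var (# 2)) $ₚ (var (# 2) , :- var (# 1)))
      (detₚ (matₚ 0ₚ (var (# 0)) (var (# 1)) (var (# 2))) , 0ₚ) refl refl
  ... | yes refl | yes refl = (1# , 0#) , ker , λ v≡0 → 0≢1 (sym (cong proj₁ v≡0))
    where
    ker : mat 0# b 0# d $ (1# , 0#) ≡ 0v
    ker = proveᵥ (b ∷ d ∷ []) (matₚ 0ₚ (var (# 0)) 0ₚ (var (# 1)) $ₚ (1ₚ , 0ₚ)) (0ₚ , 0ₚ) refl refl

  infix 4 _≟ᵥ_
  _≟ᵥ_ : (u v : V) → Dec (u ≡ v)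
  _≟ᵥ_ = ≡-dec _≟_ _≟_

  nonzero⇒kernel-proper : ∀ N → N ≢ O → Σ V λ v → ¬ Kernel N v
  nonzero⇒kernel-proper N@(mat a b c d) N≢O with N $ (1# , 0#) ≟ᵥ 0v | N $ (0# , 1#) ≟ᵥ 0v
  ... | no Ne₁≢0 | _ = (1# , 0#) , Ne₁≢0
  ... | _ | no Ne₂≢0 = (0# , 1#) , Ne₂≢0
  ... | yes Ne₁≡0 | yes Ne₂≡0 = ⊥-elim (N≢O (mat-cong
    (trans (sym (column₁ a b)) (cong proj₁ Ne₁≡0)) (trans (sym (column₂ a b)) (cong proj₁ Ne₂≡0))
    (trans (sym (column₁ c d)) (cong proj₂ Ne₁≡0)) (trans (sym (column₂ c d)) (cong proj₂ Ne₂≡0))))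
    where
    column₁ : ∀ x y → x * 1# + y * 0# ≡ x
    column₁ = solve 2 (λ x y → x :* 1ₚ :+ y :* 0ₚ := x) refl
    column₂ : ∀ x y → x * 0# + y * 1# ≡ y
    column₂ = solve 2 (λ x y → x :* 0ₚ :+ y :* 1ₚ := y) refl

  module _ {J : Set} {P : J → Set} {M : J → M2} where

    kernel-invariantSubspace : ∀ N → det N ≡ 0# → N ≢ O → (∀ i → P i → M i ⊗ N ≡ N ⊗ M i) →
      InvariantSubspace P M
    kernel-invariantSubspace N det≡0 N≢O comm = record
      { W         = Kernel N
      ; subspace  = kernel-subspace N
      ; nonzero   = singular⇒kernel-nonzero N det≡0
      ; proper    = nonzero⇒kernel-proper N N≢O
      ; invariant = λ i Pi → comm⇒kernel-invariant (comm i Pi)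
      }

    nonscalar-commutant-invariant : AlgebraicallyClosed K → ∀ A → ¬ Scalar A →
      (∀ i → P i → A ⊗ M i ≡ M i ⊗ A) → InvariantSubspace P M
    nonscalar-commutant-invariant closed A nonscalar comm with eigenvalue closed A
    ... | l , det≡0 = kernel-invariantSubspace (A ⊟ l ⊙ I) det≡0 N≢O commN
      where
      N≢O : A ⊟ l ⊙ I ≢ O
      N≢O N≡O = nonscalar (l , ⊟≡O⇒≡ N≡O)
      commN : ∀ i → P i → M i ⊗ (A ⊟ l ⊙ I) ≡ (A ⊟ l ⊙ I) ⊗ M i
      commN i Pi = sym ([,]≡O⇒comm (trans ([,]-⊟⊙I A (M i) l) (≡⇒⊟≡O (comm i Pi))))

    commuting-family-invariant : AlgebraicallyClosed K → Dec (Σ J λ i → P i × ¬ Scalar (M i)) →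
      (∀ i j → P i → P j → M i ⊗ M j ≡ M j ⊗ M i) → InvariantSubspace P M
    commuting-family-invariant closed (yes (i , Pi , nonscalar)) comm =
      nonscalar-commutant-invariant closed (M i) nonscalar (λ j Pj → comm i j Pi Pj)
    commuting-family-invariant closed (no none) _ =
      nonscalar-commutant-invariant closed E₁₁ E₁₁-nonscalar (λ j Pj → sym (scalar-central (scalar j Pj) E₁₁))
      where
      scalar : ∀ j → P j → Scalar (M j)
      scalar j Pj = decidable-stable (scalar? (M j)) (λ nonscalar → none (j , Pj , nonscalar))

module Characteristic (K : Field) where
  open Field K
  open FieldSolver K using (commutativeRing)
  open CommutativeRing commutativeRing using (+-assoc; +-identityˡ; +-identityʳ)

  fromℕ-parity : 1# + 1# ≡ 0# → ∀ n → (2 ∣ n × fromℕ n ≡ 0#) ⊎ fromℕ n ≡ 1#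
  fromℕ-parity 2≡0 zero          = inj₁ (divides 0 refl , refl)
  fromℕ-parity 2≡0 (suc zero)    = inj₂ (+-identityʳ 1#)
  fromℕ-parity 2≡0 (suc (suc n)) =
    Sum.map (Product.map (∣m∣n⇒∣m+n (∣-refl {2})) (trans fromℕ[2+n]≡fromℕ[n])) (trans fromℕ[2+n]≡fromℕ[n])
      (fromℕ-parity 2≡0 n)
    where
    fromℕ[2+n]≡fromℕ[n] : fromℕ (2 ℕ.+ n) ≡ fromℕ n
    fromℕ[2+n]≡fromℕ[n] = begin
      1# + (1# + fromℕ n)   ≡⟨ sym (+-assoc 1# 1# (fromℕ n)) ⟩
      (1# + 1#) + fromℕ n   ≡⟨ cong (_+ fromℕ n) 2≡0 ⟩
      0# + fromℕ n          ≡⟨ +-identityˡ (fromℕ n) ⟩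
      fromℕ n               ∎
      where open ≡-Reasoning

  odd-characteristic⇒2≢0 : ∀ {p} → Prime p → 2 < p → HasCharacteristic K p → 1# + 1# ≢ 0#
  odd-characteristic⇒2≢0 {p} p-prime 2<p p≡0 2≡0 with fromℕ-parity 2≡0 p
  ... | inj₁ (2∣p , _) = Prime.notComposite p-prime (composite 2<p 2∣p)
  ... | inj₂ p≡1       = 0≢1 (trans (sym p≡0) p≡1)

module Subgroups (G : Group 0ℓ 0ℓ) where
  open Group G renaming (Carrier to ∣G∣)
  open GroupStuff G
  open Algebra.Properties.Group G using (⁻¹-involutive; //-rightDividesʳ)

  index-two⇒decidable : ∀ {H} → IsSubgroup H → HasIndexTwo H → ∀ x → Dec (H x)
  index-two⇒decidable {H} H-subgroup (a , a∉H , cosets) x with cosets x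
  ... | inj₁ x∈H   = yes x∈H
  ... | inj₂ a⁻¹x∈H = no λ x∈H → a∉H (H-resp (⁻¹-involutive a)
                        (⁻¹-mem (H-resp (//-rightDividesʳ x (a ⁻¹)) (∙-mem a⁻¹x∈H (⁻¹-mem x∈H)))))
    where open IsSubgroup H-subgroup renaming (resp to H-resp)

  finite-search : IsFinite → ∀ {Q : ∣G∣ → Set} → (∀ {x y} → x ≈ y → Q x → Q y) → (∀ x → Dec (Q x)) →
    Dec (Σ ∣G∣ Q)
  finite-search (xs , cover) Q-resp Q? with any? Q? xs
  ... | yes Q-somewhere = yes (satisfied Q-somewhere)
  ... | no  Q-nowhere   = no λ (x , Qx) → Q-nowhere (Any.map (λ x≈y → Q-resp x≈y Qx) (cover x))

module Representations (K : Field) (G : Group 0ℓ 0ℓ) where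
  open Field K using (0#; 1#; _+_)
  open Linear K
  open Matrices K using (Scalar; scalar?; trace-orthogonal⇒comm)
  open Group G using (_∙_; ε; identityˡ) renaming (Carrier to ∣G∣; sym to ≈-sym)
  open GroupStuff G
  open Rep K G
  open Subgroups G

  module _ {ρ : ∣G∣ → M2} (ρ-rep : IsRepresentation ρ) where
    open IsRepresentation ρ-rep renaming (resp to ρ-resp)

    nonscalar? : IsFinite → ∀ {H} → IsSubgroup H → HasIndexTwo H → Dec (Σ ∣G∣ λ h → H h × ¬ Scalar (ρ h))
    nonscalar? G-finite H-subgroup H-index2 = finite-search G-finite
      (λ x≈y (Hx , nonscalar) → H-resp x≈y Hx , λ scalar → nonscalar (subst Scalar (sym (ρ-resp x≈y)) scalar))
      (λ h → index-two⇒decidable H-subgroup H-index2 h ×-dec ¬? (scalar? (ρ h)))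
      where open IsSubgroup H-subgroup renaming (resp to H-resp)

    traceless-coset⇒commuting : 1# + 1# ≢ 0# → ∀ {H c} → IsSubgroup H → (∀ h → H h → tr (ρ (h ∙ c)) ≡ 0#) →
      ∀ h h′ → H h → H h′ → ρ h ⊗ ρ h′ ≡ ρ h′ ⊗ ρ h
    traceless-coset⇒commuting 2≢0 {H} {c} H-subgroup tr≡0 h h′ h∈H h′∈H =
      trace-orthogonal⇒comm 2≢0 trC (invertible c) (trρc h∈H) (trρc h′∈H) trhh′c
      where
      open IsSubgroup H-subgroup
      trρc : ∀ {g} → H g → tr (ρ g ⊗ ρ c) ≡ 0#
      trρc {g} g∈H = trans (cong tr (sym (hom g c))) (tr≡0 g g∈H)
      trC : tr (ρ c) ≡ 0#
      trC = trans (cong tr (ρ-resp (≈-sym (identityˡ c)))) (tr≡0 ε ε-mem)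
      trhh′c : tr ((ρ h ⊗ ρ h′) ⊗ ρ c) ≡ 0#
      trhh′c = trans (cong (λ M → tr (M ⊗ ρ c)) (sym (hom h h′))) (trρc (∙-mem h∈H h′∈H))

open Matrices using (commuting-family-invariant)
open Characteristic using (odd-characteristic⇒2≢0)
open Representations using (nonscalar?; traceless-coset⇒commuting)

-- Only the invertibility of ρ c enters, neither its order nor c ∉ H.
lemma6p3 :
    (p : ℕ) → Prime p → 2 < p →
    (K : Field) → IsAlgebraicClosureOfFp p K →
    (G : Group 0ℓ 0ℓ) → GroupStuff.IsFinite G →
    (H : Group.Carrier G → Set) → GroupStuff.IsSubgroup G H → GroupStuff.HasIndexTwo G H →
    (ρ : Group.Carrier G → Linear.M2 K) →
    Rep.IsRepresentation K G ρ → Rep.Faithful K G ρ → Rep.Irreducible K G ρ →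
    (c : Group.Carrier G) → ¬ H c → GroupStuff.HasOrderTwo G c →
    (∀ h → H h → Linear.tr K (ρ (Group._∙_ G h c)) ≡ Field.0# K) →
    Rep.ReducibleOn K G H ρ
lemma6p3 p p-prime 2<p K K≅F̄p G G-finite H H-subgroup H-index2 ρ ρ-rep _ _ c _ _ tr≡0 =
  commuting-family-invariant K algClosed
    (nonscalar? K G ρ-rep G-finite H-subgroup H-index2)
    (traceless-coset⇒commuting K G ρ-rep (odd-characteristic⇒2≢0 K p-prime 2<p characteristic) H-subgroup tr≡0)
  where open IsAlgebraicClosureOfFp K≅F̄p
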